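{- $g_{\mathbb{Z}_3[\sqrt[3]{3}]}(6) = 9$.
   Context: For a ring $R$ and an integer $k > 1$, let $R^k$ denote the additive semigroup generated by all $k$-th powers of elements of $R$. The Waring number $g_R(k)$ is the smallest positive integer such that every element of $R^k$ can be written as a sum of at most $g_R(k)$ $k$-th powers of elements of $R$. $\mathbb{Z}_3$ denotes the $3$-adic integers and $\mathbb{Z}_3[\sqrt[3]{3}]$ is the ring of integers of $\mathbb{Q}_3(\sqrt[3]{3})$. -}

module Defs where

open import Data.Nat using (ℕ; zero; suc; _+_; _*_; _^_; _≤_; _<_; NonZero)
open import Data.Nat.Properties using (m^n≢0)
open import Data.Nat.DivMod using (_%_; %-distribˡ-+; %-distribˡ-*)
open import Data.List using (List; []; _∷_; length)
open import Data.Product using (Σ; _×_; _,_)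
open import Relation.Binary.PropositionalEquality using (_≡_; refl; cong₂; trans; sym)
open import Relation.Nullary using (¬_)

-- The 3-adic integers ℤ₃ as the inverse limit  lim ℤ/3ⁿ :
-- a coherent sequence of naturals (residues), xₙ₊₁ ≡ xₙ (mod 3ⁿ),
-- with equality  x ≈ y  iff  xₙ ≡ yₙ (mod 3ⁿ) for all n.

_mod3^_ : ℕ → ℕ → ℕ
a mod3^ n = _%_ a (3 ^ n) {{m^n≢0 3 n}}

_≡[mod3^_]_ : ℕ → ℕ → ℕ → Set
a ≡[mod3^ n ] b = a mod3^ n ≡ b mod3^ n

record ℤ₃ : Set where
  constructor mkℤ₃
  field
    seq : ℕ → ℕ
    coh : ∀ n → seq (suc n) ≡[mod3^ n ] seq n
open ℤ₃ public

_≈₃_ : ℤ₃ → ℤ₃ → Set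
x ≈₃ y = ∀ n → seq x n ≡[mod3^ n ] seq y n

const₃ : ℕ → ℤ₃
const₃ k = mkℤ₃ (λ _ → k) (λ _ → refl)

_+₃_ : ℤ₃ → ℤ₃ → ℤ₃
x +₃ y = mkℤ₃ (λ n → seq x n + seq y n) pf
  where
  pf : ∀ n → (seq x (suc n) + seq y (suc n)) ≡[mod3^ n ] (seq x n + seq y n)
  pf n = trans (%-distribˡ-+ (seq x (suc n)) (seq y (suc n)) (3 ^ n) {{m^n≢0 3 n}})
           (trans (cong₂ (λ a b → (a + b) mod3^ n) (coh x n) (coh y n))
             (sym (%-distribˡ-+ (seq x n) (seq y n) (3 ^ n) {{m^n≢0 3 n}})))

_*₃_ : ℤ₃ → ℤ₃ → ℤ₃
x *₃ y = mkℤ₃ (λ n → seq x n * seq y n) pf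
  where
  pf : ∀ n → (seq x (suc n) * seq y (suc n)) ≡[mod3^ n ] (seq x n * seq y n)
  pf n = trans (%-distribˡ-* (seq x (suc n)) (seq y (suc n)) (3 ^ n) {{m^n≢0 3 n}})
           (trans (cong₂ (λ a b → (a * b) mod3^ n) (coh x n) (coh y n))
             (sym (%-distribˡ-* (seq x n) (seq y n) (3 ^ n) {{m^n≢0 3 n}})))

-- R = ℤ₃[∛3] = ℤ₃[π]/(π³ - 3), elements a + bπ + cπ² with a b c ∈ ℤ₃.

record R : Set where
  constructor ⟨_,_,_⟩
  field
    c0 c1 c2 : ℤ₃
open R public

_≈_ : R → R → Set
x ≈ y = (c0 x ≈₃ c0 y) × (c1 x ≈₃ c1 y) × (c2 x ≈₃ c2 y)

0R : R
0R = ⟨ const₃ 0 , const₃ 0 , const₃ 0 ⟩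

_+R_ : R → R → R
x +R y = ⟨ c0 x +₃ c0 y , c1 x +₃ c1 y , c2 x +₃ c2 y ⟩

-- (a + bπ + cπ²)(d + eπ + fπ²) with π³ = 3
_*R_ : R → R → R
⟨ a , b , c ⟩ *R ⟨ d , e , f ⟩ =
  ⟨ (a *₃ d) +₃ (const₃ 3 *₃ ((b *₃ f) +₃ (c *₃ e)))
  , ((a *₃ e) +₃ (b *₃ d)) +₃ (const₃ 3 *₃ (c *₃ f))
  , ((a *₃ f) +₃ (b *₃ e)) +₃ (c *₃ d) ⟩

1R : R
1R = ⟨ const₃ 1 , const₃ 0 , const₃ 0 ⟩

_^R_ : R → ℕ → R
x ^R zero = 1R
x ^R suc k = x *R (x ^R k)

sumPow : ℕ → List R → R
sumPow k [] = 0R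
sumPow k (y ∷ ys) = (y ^R k) +R sumPow k ys

InRk : ℕ → R → Set
InRk k x = Σ (List R) λ ys → (1 ≤ length ys) × (x ≈ sumPow k ys)

WaringBound : ℕ → ℕ → Set
WaringBound k g = ∀ x → InRk k x →
  Σ (List R) λ ys → (length ys ≤ g) × (x ≈ sumPow k ys)

WaringNumber : ℕ → ℕ → Set
WaringNumber k g = (1 ≤ g) × WaringBound k g ×
  (∀ h → 1 ≤ h → h < g → ¬ WaringBound k h)

module Submission where

-- Write R = ℤ₃[π] with π³ = 3 and work with the truncations modulo 3ⁿ of the coordinates
-- of t = t₀ + t₁π + t₂π².  Modulo 9 the sixth power of a non-unit is 0 and that of a unit
-- is 1 + 3b + 3bπ + 3cπ².  So every sum of sixth powers is congruent to an integer modulo 3,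
-- and t₀ − t₁ (mod 9) counts its unit summands; hence 3π², the residue of 8·1⁶ + (1 + 2π²)⁶,
-- needs nine summands.  Conversely every such residue is u⁶ + m·1⁶ with u a unit and m ≤ 8,
-- and because u⁶ ≡ 1 (mod 3) makes 2u⁵ invertible modulo 3, Hensel lifting turns u into a z
-- with x = z⁶ + m·1⁶ exactly.

open import Defs
open import Algebra.Bundles using (CommutativeSemiring)
open import Algebra.Structures using (IsSemigroup)
open import Algebra.Structures.Biased using (isCommutativeMonoidˡ; isCommutativeSemiringˡ)
open import Data.Fin using (Fin; toℕ; fromℕ<)
open import Data.Fin.Properties using (all?; toℕ-fromℕ<)
open import Data.List using (List; []; _∷_; map; length; replicate)
open import Data.List.Properties using (length-map; length-replicate)
open import Data.Maybe using (Maybe; just; nothing)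
open import Data.Nat using (ℕ; zero; suc; _+_; _*_; _^_; _≤_; _<_; z≤n; s≤s; _≤′_; ≤′-refl; ≤′-step; _≟_; _/_)
open import Data.Nat.DivMod
  using (%-distribˡ-+; %-distribˡ-*; m∣n⇒o%n%m≡o%m; [m+kn]%n≡m%n; m≡m%n+[m/n]*n; m%n%n≡m%n; m*n%n≡0; m%n<n; m<n⇒m%n≡m)
open import Data.Nat.Divisibility using (_∣_; divides; ∣-refl; n∣m⇒m%n≡0; ∣m⇒∣m*n)
open import Data.Nat.Properties
  using (+-assoc; +-comm; +-identityʳ; *-comm; *-identityˡ; *-zeroʳ; m^n≢0; ≤-trans; ≤-pred;
         n≤1+n; m≤n+m; m≤n⇒m≤1+n; ≤⇒≤′; ≤′⇒≤; m≤n⇒∃[o]m+o≡n; ^-distribˡ-+-*)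
import Data.Nat.Tactic.RingSolver as ℕ-Solver
open import Data.Product using (Σ; _×_; _,_; proj₁; proj₂)
import Data.Product as Product
open import Data.Sum using (_⊎_; inj₁; inj₂)
import Data.Sum as Sum
open import Function using (_∘_)
open import Level using (0ℓ)
open import Relation.Binary.Bundles using (Setoid)
open import Relation.Binary.PropositionalEquality
import Relation.Binary.Reasoning.Setoid as SetoidReasoning
open import Relation.Nullary using (¬_; Dec)
open import Relation.Nullary.Decidable using (True; toWitness; map′; _×-dec_; _⊎-dec_; _→-dec_)
open import Tactic.RingSolver using (solve-∀)
import Tactic.RingSolver.Core.AlmostCommutativeRing as ACR

-- The semiring ℕ[π] with π³ = 3

-- tri a b c stands for a + bπ + cπ²; truncate (below) turns _+R_ and _*R_ into _+ᵀ_ and _*ᵀ_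
-- definitionally.
data Tri : Set where
  tri : ℕ → ℕ → ℕ → Tri

t₀ t₁ t₂ : Tri → ℕ
t₀ (tri a _ _) = a
t₁ (tri _ b _) = b
t₂ (tri _ _ c) = c

infixl 6 _+ᵀ_
infixl 7 _*ᵀ_ _·ᵀ_

_+ᵀ_ : Tri → Tri → Tri
tri a b c +ᵀ tri d e f = tri (a + d) (b + e) (c + f)

_*ᵀ_ : Tri → Tri → Tri
tri a b c *ᵀ tri d e f =
  tri ((a * d) + 3 * ((b * f) + (c * e)))
      (((a * e) + (b * d)) + 3 * (c * f))
      (((a * f) + (b * e)) + (c * d))

_·ᵀ_ : ℕ → Tri → Tri
k ·ᵀ tri a b c = tri (k * a) (k * b) (k * c)

ι : ℕ → Tri
ι a = tri a 0 0

0ᵀ 1ᵀ : Tri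
0ᵀ = ι 0
1ᵀ = ι 1

tri-cong : ∀ {a b c a′ b′ c′} → a ≡ a′ → b ≡ b′ → c ≡ c′ → tri a b c ≡ tri a′ b′ c′
tri-cong refl refl refl = refl

Coordinatewise : Tri → Tri → Set
Coordinatewise x y = t₀ x ≡ t₀ y × t₁ x ≡ t₁ y × t₂ x ≡ t₂ y

coordinatewise : ∀ {x y} → Coordinatewise x y → x ≡ y
coordinatewise {tri _ _ _} {tri _ _ _} (refl , refl , refl) = refl

+ᵀ-assoc : ∀ x y z → (x +ᵀ y) +ᵀ z ≡ x +ᵀ (y +ᵀ z)
+ᵀ-assoc (tri a b c) (tri d e f) (tri g h i) = tri-cong (+-assoc a d g) (+-assoc b e h) (+-assoc c f i)

+ᵀ-comm : ∀ x y → x +ᵀ y ≡ y +ᵀ x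
+ᵀ-comm (tri a b c) (tri d e f) = tri-cong (+-comm a d) (+-comm b e) (+-comm c f)

+ᵀ-identityˡ : ∀ x → 0ᵀ +ᵀ x ≡ x
+ᵀ-identityˡ (tri a b c) = refl

+ᵀ-identityʳ : ∀ x → x +ᵀ 0ᵀ ≡ x
+ᵀ-identityʳ (tri a b c) = tri-cong (+-identityʳ a) (+-identityʳ b) (+-identityʳ c)

*ᵀ-assoc : ∀ x y z → (x *ᵀ y) *ᵀ z ≡ x *ᵀ (y *ᵀ z)
*ᵀ-assoc x y z = coordinatewise (coordinates x y z)
  where
  coordinates : ∀ x y z → Coordinatewise ((x *ᵀ y) *ᵀ z) (x *ᵀ (y *ᵀ z))
  coordinates (tri a b c) (tri d e f) (tri g h i) = p₀ a b c d e f g h i , p₁ a b c d e f g h i , p₂ a b c d e f g h i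
    where
    p₀ : ∀ a b c d e f g h i →
      (a * d + 3 * (b * f + c * e)) * g + 3 * ((a * e + b * d + 3 * (c * f)) * i + (a * f + b * e + c * d) * h) ≡
      a * (d * g + 3 * (e * i + f * h)) + 3 * (b * (d * i + e * h + f * g) + c * (d * h + e * g + 3 * (f * i)))
    p₀ = ℕ-Solver.solve-∀
    p₁ : ∀ a b c d e f g h i →
      (a * d + 3 * (b * f + c * e)) * h + (a * e + b * d + 3 * (c * f)) * g + 3 * ((a * f + b * e + c * d) * i) ≡
      a * (d * h + e * g + 3 * (f * i)) + b * (d * g + 3 * (e * i + f * h)) + 3 * (c * (d * i + e * h + f * g))
    p₁ = ℕ-Solver.solve-∀
    p₂ : ∀ a b c d e f g h i →
      (a * d + 3 * (b * f + c * e)) * i + (a * e + b * d + 3 * (c * f)) * h + (a * f + b * e + c * d) * g ≡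
      a * (d * i + e * h + f * g) + b * (d * h + e * g + 3 * (f * i)) + c * (d * g + 3 * (e * i + f * h))
    p₂ = ℕ-Solver.solve-∀

*ᵀ-comm : ∀ x y → x *ᵀ y ≡ y *ᵀ x
*ᵀ-comm x y = coordinatewise (coordinates x y)
  where
  coordinates : ∀ x y → Coordinatewise (x *ᵀ y) (y *ᵀ x)
  coordinates (tri a b c) (tri d e f) = p₀ a b c d e f , p₁ a b c d e f , p₂ a b c d e f
    where
    p₀ : ∀ a b c d e f → a * d + 3 * (b * f + c * e) ≡ d * a + 3 * (e * c + f * b)
    p₀ = ℕ-Solver.solve-∀
    p₁ : ∀ a b c d e f → a * e + b * d + 3 * (c * f) ≡ d * b + e * a + 3 * (f * c)
    p₁ = ℕ-Solver.solve-∀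
    p₂ : ∀ a b c d e f → a * f + b * e + c * d ≡ d * c + e * b + f * a
    p₂ = ℕ-Solver.solve-∀

*ᵀ-distribʳ : ∀ x y z → (y +ᵀ z) *ᵀ x ≡ y *ᵀ x +ᵀ z *ᵀ x
*ᵀ-distribʳ x y z = coordinatewise (coordinates x y z)
  where
  coordinates : ∀ x y z → Coordinatewise ((y +ᵀ z) *ᵀ x) (y *ᵀ x +ᵀ z *ᵀ x)
  coordinates (tri a b c) (tri d e f) (tri g h i) = p₀ a b c d e f g h i , p₁ a b c d e f g h i , p₂ a b c d e f g h i
    where
    p₀ : ∀ a b c d e f g h i →
      (d + g) * a + 3 * ((e + h) * c + (f + i) * b) ≡ (d * a + 3 * (e * c + f * b)) + (g * a + 3 * (h * c + i * b))
    p₀ = ℕ-Solver.solve-∀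
    p₁ : ∀ a b c d e f g h i →
      (d + g) * b + (e + h) * a + 3 * ((f + i) * c) ≡ (d * b + e * a + 3 * (f * c)) + (g * b + h * a + 3 * (i * c))
    p₁ = ℕ-Solver.solve-∀
    p₂ : ∀ a b c d e f g h i →
      (d + g) * c + (e + h) * b + (f + i) * a ≡ (d * c + e * b + f * a) + (g * c + h * b + i * a)
    p₂ = ℕ-Solver.solve-∀

*ᵀ-zeroˡ : ∀ x → 0ᵀ *ᵀ x ≡ 0ᵀ
*ᵀ-zeroˡ (tri a b c) = refl

ι-*ᵀ : ∀ k x → ι k *ᵀ x ≡ k ·ᵀ x
ι-*ᵀ k (tri a b c) =
  tri-cong (+-identityʳ (k * a)) (trans (+-identityʳ _) (+-identityʳ (k * b))) (trans (+-identityʳ _) (+-identityʳ (k * c)))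

ι-*ᵀ-ι : ∀ m n → ι m *ᵀ ι n ≡ ι (m * n)
ι-*ᵀ-ι m n = trans (ι-*ᵀ m (ι n)) (tri-cong refl (*-zeroʳ m) (*-zeroʳ m))

*ᵀ-identityˡ : ∀ x → 1ᵀ *ᵀ x ≡ x
*ᵀ-identityˡ x = trans (ι-*ᵀ 1 x) (·ᵀ-identityˡ x)
  where
  ·ᵀ-identityˡ : ∀ x → 1 ·ᵀ x ≡ x
  ·ᵀ-identityˡ (tri a b c) = tri-cong (*-identityˡ a) (*-identityˡ b) (*-identityˡ c)

*ᵀ-identityʳ : ∀ x → x *ᵀ 1ᵀ ≡ x
*ᵀ-identityʳ x = trans (*ᵀ-comm x 1ᵀ) (*ᵀ-identityˡ x)

Tri-commutativeSemiring : CommutativeSemiring 0ℓ 0ℓ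
Tri-commutativeSemiring = record
  { Carrier = Tri ; _≈_ = _≡_ ; _+_ = _+ᵀ_ ; _*_ = _*ᵀ_ ; 0# = 0ᵀ ; 1# = 1ᵀ
  ; isCommutativeSemiring = isCommutativeSemiringˡ record
      { +-isCommutativeMonoid = isCommutativeMonoidˡ record
          { isSemigroup = semigroup _+ᵀ_ +ᵀ-assoc ; identityˡ = +ᵀ-identityˡ ; comm = +ᵀ-comm }
      ; *-isCommutativeMonoid = isCommutativeMonoidˡ record
          { isSemigroup = semigroup _*ᵀ_ *ᵀ-assoc ; identityˡ = *ᵀ-identityˡ ; comm = *ᵀ-comm }
      ; distribʳ = *ᵀ-distribʳ
      ; zeroˡ = *ᵀ-zeroˡ
      }
  }
  where
  semigroup : ∀ _∙_ → (∀ x y z → (x ∙ y) ∙ z ≡ x ∙ (y ∙ z)) → IsSemigroup _≡_ _∙_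
  semigroup _∙_ assoc = record { isMagma = record { isEquivalence = isEquivalence ; ∙-cong = cong₂ _∙_ } ; assoc = assoc }

Tri-ring : ACR.AlmostCommutativeRing 0ℓ 0ℓ
Tri-ring = ACR.fromCommutativeSemiring Tri-commutativeSemiring is-0ᵀ
  where
  is-0ᵀ : ∀ x → Maybe (0ᵀ ≡ x)
  is-0ᵀ (tri 0 0 0) = just refl
  is-0ᵀ _ = nothing

-- The solver's own exponentiation, so that solve-∀ Tri-ring reads powers; truncate-^ relates it to _^R_.
infixr 8 _^ᵀ_
_^ᵀ_ : Tri → ℕ → Tri
_^ᵀ_ = ACR.AlmostCommutativeRing._^_ Tri-ring

binomial-6 : ∀ z e → (z +ᵀ e) ^ᵀ 6 ≡
  z ^ᵀ 6 +ᵀ ι 6 *ᵀ z ^ᵀ 5 *ᵀ e +ᵀ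
  e ^ᵀ 2 *ᵀ (ι 15 *ᵀ z ^ᵀ 4 +ᵀ e *ᵀ (ι 20 *ᵀ z ^ᵀ 3 +ᵀ ι 15 *ᵀ z ^ᵀ 2 *ᵀ e +ᵀ ι 6 *ᵀ z *ᵀ e ^ᵀ 2 +ᵀ e ^ᵀ 3))
binomial-6 = solve-∀ Tri-ring

-- Congruences modulo powers of 3

mod3^-+ : ∀ {k a a′ b b′} → a ≡[mod3^ k ] a′ → b ≡[mod3^ k ] b′ → (a + b) ≡[mod3^ k ] (a′ + b′)
mod3^-+ {k} {a} {a′} {b} {b′} a≡a′ b≡b′ = begin
  (a + b) mod3^ k                         ≡⟨ %-distribˡ-+ a b (3 ^ k) {{m^n≢0 3 k}} ⟩
  ((a mod3^ k) + (b mod3^ k)) mod3^ k     ≡⟨ cong₂ (λ u v → (u + v) mod3^ k) a≡a′ b≡b′ ⟩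
  ((a′ mod3^ k) + (b′ mod3^ k)) mod3^ k   ≡⟨ %-distribˡ-+ a′ b′ (3 ^ k) {{m^n≢0 3 k}} ⟨
  (a′ + b′) mod3^ k                       ∎
  where open ≡-Reasoning

mod3^-* : ∀ {k a a′ b b′} → a ≡[mod3^ k ] a′ → b ≡[mod3^ k ] b′ → (a * b) ≡[mod3^ k ] (a′ * b′)
mod3^-* {k} {a} {a′} {b} {b′} a≡a′ b≡b′ = begin
  (a * b) mod3^ k                         ≡⟨ %-distribˡ-* a b (3 ^ k) {{m^n≢0 3 k}} ⟩
  ((a mod3^ k) * (b mod3^ k)) mod3^ k     ≡⟨ cong₂ (λ u v → (u * v) mod3^ k) a≡a′ b≡b′ ⟩
  ((a′ mod3^ k) * (b′ mod3^ k)) mod3^ k   ≡⟨ %-distribˡ-* a′ b′ (3 ^ k) {{m^n≢0 3 k}} ⟨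
  (a′ * b′) mod3^ k                       ∎
  where open ≡-Reasoning

3^k∣3^m : ∀ {k m} → k ≤ m → 3 ^ k ∣ 3 ^ m
3^k∣3^m {k} k≤m with m≤n⇒∃[o]m+o≡n k≤m
... | o , refl = divides (3 ^ o) (trans (^-distribˡ-+-* 3 k o) (*-comm (3 ^ k) (3 ^ o)))

mod3^-weaken : ∀ {k m a b} → k ≤ m → a ≡[mod3^ m ] b → a ≡[mod3^ k ] b
mod3^-weaken {k} {m} {a} {b} k≤m a≡b = begin
  a mod3^ k             ≡⟨ coarsen a ⟨
  (a mod3^ m) mod3^ k   ≡⟨ cong (_mod3^ k) a≡b ⟩
  (b mod3^ m) mod3^ k   ≡⟨ coarsen b ⟩
  b mod3^ k             ∎
  where
  open ≡-Reasoning
  coarsen : ∀ c → (c mod3^ m) mod3^ k ≡ c mod3^ k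
  coarsen c = m∣n⇒o%n%m≡o%m (3 ^ k) (3 ^ m) c {{m^n≢0 3 k}} {{m^n≢0 3 m}} (3^k∣3^m k≤m)

_div3^_ : ℕ → ℕ → ℕ
a div3^ m = _/_ a (3 ^ m) {{m^n≢0 3 m}}

base-3^-expansion : ∀ m a → a ≡ a mod3^ m + 3 ^ m * (a div3^ m)
base-3^-expansion m a =
  trans (m≡m%n+[m/n]*n a (3 ^ m) {{m^n≢0 3 m}}) (cong (a mod3^ m +_) (*-comm (a div3^ m) (3 ^ m)))

mod3^-suc-digit : ∀ m r q → (r + 3 ^ m * q) ≡[mod3^ suc m ] (r + 3 ^ m * (q mod3^ 1))
mod3^-suc-digit m r q = begin
  (r + 3 ^ m * q) mod3^ suc m                                     ≡⟨ cong (λ q′ → (r + 3 ^ m * q′) mod3^ suc m) (base-3^-expansion 1 q) ⟩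
  (r + 3 ^ m * (q mod3^ 1 + 3 * (q div3^ 1))) mod3^ suc m         ≡⟨ cong (_mod3^ suc m) (regroup r (3 ^ m) (q mod3^ 1) (q div3^ 1)) ⟩
  (r + 3 ^ m * (q mod3^ 1) + q div3^ 1 * 3 ^ suc m) mod3^ suc m   ≡⟨ [m+kn]%n≡m%n _ (q div3^ 1) (3 ^ suc m) {{m^n≢0 3 (suc m)}} ⟩
  (r + 3 ^ m * (q mod3^ 1)) mod3^ suc m                           ∎
  where
  open ≡-Reasoning
  regroup : ∀ r M d h → r + M * (d + 3 * h) ≡ r + M * d + h * (3 * M)
  regroup = ℕ-Solver.solve-∀

mod3^-lift : ∀ m {a b} w → a ≡[mod3^ m ] b → (w + a div3^ m) ≡[mod3^ 1 ] (b div3^ m) →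
             (a + 3 ^ m * w) ≡[mod3^ suc m ] b
mod3^-lift m {a} {b} w a≡b digit = begin
  (a + 3 ^ m * w) mod3^ suc m                                   ≡⟨ cong (_mod3^ suc m) regroup ⟩
  (a mod3^ m + 3 ^ m * (w + a div3^ m)) mod3^ suc m             ≡⟨ mod3^-suc-digit m _ _ ⟩
  (a mod3^ m + 3 ^ m * ((w + a div3^ m) mod3^ 1)) mod3^ suc m   ≡⟨ cong₂ (λ r d → (r + 3 ^ m * d) mod3^ suc m) a≡b digit ⟩
  (b mod3^ m + 3 ^ m * ((b div3^ m) mod3^ 1)) mod3^ suc m       ≡⟨ mod3^-suc-digit m _ _ ⟨
  (b mod3^ m + 3 ^ m * (b div3^ m)) mod3^ suc m                 ≡⟨ cong (_mod3^ suc m) (base-3^-expansion m b) ⟨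
  b mod3^ suc m                                                 ∎
  where
  open ≡-Reasoning
  shuffle : ∀ r M q w → r + M * q + M * w ≡ r + M * (w + q)
  shuffle = ℕ-Solver.solve-∀
  regroup : a + 3 ^ m * w ≡ a mod3^ m + 3 ^ m * (w + a div3^ m)
  regroup = trans (cong (_+ 3 ^ m * w) (base-3^-expansion m a)) (shuffle (a mod3^ m) (3 ^ m) (a div3^ m) w)

infix 4 _≋[_]_
record _≋[_]_ (x : Tri) (k : ℕ) (y : Tri) : Set where
  constructor mk≋
  field
    ≋₀ : t₀ x ≡[mod3^ k ] t₀ y
    ≋₁ : t₁ x ≡[mod3^ k ] t₁ y
    ≋₂ : t₂ x ≡[mod3^ k ] t₂ y
open _≋[_]_

≋-refl : ∀ {k x} → x ≋[ k ] x
≋-refl = mk≋ refl refl refl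

≋-sym : ∀ {k x y} → x ≋[ k ] y → y ≋[ k ] x
≋-sym (mk≋ e₀ e₁ e₂) = mk≋ (sym e₀) (sym e₁) (sym e₂)

≋-trans : ∀ {k x y z} → x ≋[ k ] y → y ≋[ k ] z → x ≋[ k ] z
≋-trans (mk≋ e₀ e₁ e₂) (mk≋ f₀ f₁ f₂) = mk≋ (trans e₀ f₀) (trans e₁ f₁) (trans e₂ f₂)

≡⇒≋ : ∀ {k x y} → x ≡ y → x ≋[ k ] y
≡⇒≋ refl = ≋-refl

≋-setoid : ℕ → Setoid 0ℓ 0ℓ
≋-setoid k = record
  { Carrier = Tri ; _≈_ = _≋[ k ]_
  ; isEquivalence = record { refl = ≋-refl ; sym = ≋-sym ; trans = ≋-trans } }

module ≋-Reasoning (k : ℕ) = SetoidReasoning (≋-setoid k)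

infix 4 _≋?[_]_
_≋?[_]_ : ∀ x k y → Dec (x ≋[ k ] y)
x ≋?[ k ] y = map′ (λ (e₀ , e₁ , e₂) → mk≋ e₀ e₁ e₂) (λ (mk≋ e₀ e₁ e₂) → e₀ , e₁ , e₂)
  ((t₀ x mod3^ k ≟ t₀ y mod3^ k) ×-dec (t₁ x mod3^ k ≟ t₁ y mod3^ k) ×-dec (t₂ x mod3^ k ≟ t₂ y mod3^ k))

≋-+ : ∀ {k x x′ y y′} → x ≋[ k ] x′ → y ≋[ k ] y′ → x +ᵀ y ≋[ k ] x′ +ᵀ y′
≋-+ {k} {tri _ _ _} {tri _ _ _} {tri _ _ _} {tri _ _ _} (mk≋ a b c) (mk≋ d e f) =
  mk≋ (mod3^-+ {k} a d) (mod3^-+ {k} b e) (mod3^-+ {k} c f)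

≋-* : ∀ {k x x′ y y′} → x ≋[ k ] x′ → y ≋[ k ] y′ → x *ᵀ y ≋[ k ] x′ *ᵀ y′
≋-* {k} {tri _ _ _} {tri _ _ _} {tri _ _ _} {tri _ _ _} (mk≋ a b c) (mk≋ d e f) =
  mk≋ (a ⊗ d ⊕ 3⊗ (b ⊗ f ⊕ c ⊗ e))
      (a ⊗ e ⊕ b ⊗ d ⊕ 3⊗ (c ⊗ f))
      (a ⊗ f ⊕ b ⊗ e ⊕ c ⊗ d)
  where
  infixl 6 _⊕_
  infixl 7 _⊗_
  _⊕_ : ∀ {a a′ b b′} → a ≡[mod3^ k ] a′ → b ≡[mod3^ k ] b′ → (a + b) ≡[mod3^ k ] (a′ + b′)
  _⊕_ = mod3^-+ {k}
  _⊗_ : ∀ {a a′ b b′} → a ≡[mod3^ k ] a′ → b ≡[mod3^ k ] b′ → (a * b) ≡[mod3^ k ] (a′ * b′)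
  _⊗_ = mod3^-* {k}
  3⊗ : ∀ {a a′} → a ≡[mod3^ k ] a′ → (3 * a) ≡[mod3^ k ] (3 * a′)
  3⊗ = mod3^-* {k} {3} refl

≋-+ˡ : ∀ {k y y′} x → y ≋[ k ] y′ → x +ᵀ y ≋[ k ] x +ᵀ y′
≋-+ˡ x = ≋-+ (≋-refl {x = x})

≋-+ʳ : ∀ {k x x′} y → x ≋[ k ] x′ → x +ᵀ y ≋[ k ] x′ +ᵀ y
≋-+ʳ y x≋x′ = ≋-+ x≋x′ (≋-refl {x = y})

≋-*ˡ : ∀ {k y y′} x → y ≋[ k ] y′ → x *ᵀ y ≋[ k ] x *ᵀ y′
≋-*ˡ x = ≋-* (≋-refl {x = x})

≋-*ʳ : ∀ {k x x′} y → x ≋[ k ] x′ → x *ᵀ y ≋[ k ] x′ *ᵀ y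
≋-*ʳ y x≋x′ = ≋-* x≋x′ (≋-refl {x = y})

≋-^ : ∀ {k x y} n → x ≋[ k ] y → x ^ᵀ n ≋[ k ] y ^ᵀ n
≋-^ 0 x≋y = ≋-refl
≋-^ 1 x≋y = x≋y
≋-^ (suc (suc n)) x≋y = ≋-* (≋-^ (suc n) x≋y) x≋y

≋-weaken : ∀ {k m x y} → k ≤ m → x ≋[ m ] y → x ≋[ k ] y
≋-weaken k≤m (mk≋ e₀ e₁ e₂) = mk≋ (mod3^-weaken k≤m e₀) (mod3^-weaken k≤m e₁) (mod3^-weaken k≤m e₂)

≋-vanish : ∀ {k n} x → 3 ^ k ∣ n → ι n *ᵀ x ≋[ k ] 0ᵀ
≋-vanish {k} {n} x@(tri a b c) 3^k∣n = subst (_≋[ k ] 0ᵀ) (sym (ι-*ᵀ n x)) (mk≋ (vanish a) (vanish b) (vanish c))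
  where
  vanish : ∀ a → (n * a) ≡[mod3^ k ] 0
  vanish a = trans (n∣m⇒m%n≡0 (n * a) (3 ^ k) {{m^n≢0 3 k}} (∣m⇒∣m*n a 3^k∣n))
                   (sym (m*n%n≡0 0 (3 ^ k) {{m^n≢0 3 k}}))

reduce : ℕ → Tri → Tri
reduce k x = tri (t₀ x mod3^ k) (t₁ x mod3^ k) (t₂ x mod3^ k)

≋-reduce : ∀ k x → reduce k x ≋[ k ] x
≋-reduce k x = mk≋ (idem (t₀ x)) (idem (t₁ x)) (idem (t₂ x))
  where
  idem : ∀ a → (a mod3^ k) mod3^ k ≡ a mod3^ k
  idem a = m%n%n≡m%n a (3 ^ k) {{m^n≢0 3 k}}

≋⇒reduce-≡ : ∀ {k x y} → x ≋[ k ] y → reduce k x ≡ reduce k y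
≋⇒reduce-≡ (mk≋ e₀ e₁ e₂) = tri-cong e₀ e₁ e₂

_div3^ᵀ_ : Tri → ℕ → Tri
x div3^ᵀ m = tri (t₀ x div3^ m) (t₁ x div3^ m) (t₂ x div3^ m)

base-3-split : ∀ x → x ≡ reduce 1 x +ᵀ ι 3 *ᵀ (x div3^ᵀ 1)
base-3-split x@(tri a b c) =
  trans (tri-cong (base-3^-expansion 1 a) (base-3^-expansion 1 b) (base-3^-expansion 1 c))
        (cong (reduce 1 x +ᵀ_) (sym (ι-*ᵀ 3 (x div3^ᵀ 1))))

≋-lift : ∀ m {a b} w → a ≋[ m ] b → w +ᵀ a div3^ᵀ m ≋[ 1 ] b div3^ᵀ m → a +ᵀ 3 ^ m ·ᵀ w ≋[ suc m ] b
≋-lift m {tri _ _ _} {tri _ _ _} (tri _ _ _) (mk≋ e₀ e₁ e₂) (mk≋ d₀ d₁ d₂) =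
  mk≋ (mod3^-lift m _ e₀ d₀) (mod3^-lift m _ e₁ d₁) (mod3^-lift m _ e₂ d₂)

every-residue : ∀ k {P : Tri → Set} → (∀ (a b c : Fin (3 ^ k)) → P (tri (toℕ a) (toℕ b) (toℕ c))) → ∀ x → P (reduce k x)
every-residue k {P} P-residues x =
  subst P (tri-cong (toℕ-fromℕ< _) (toℕ-fromℕ< _) (toℕ-fromℕ< _)) (P-residues (residue (t₀ x)) (residue (t₁ x)) (residue (t₂ x)))
  where
  residue : ℕ → Fin (3 ^ k)
  residue a = fromℕ< (m%n<n a (3 ^ k) {{m^n≢0 3 k}})

by-residues : ∀ k {P : Tri → Set} (P? : ∀ x → Dec (P x)) →
  True (all? λ a → all? λ b → all? λ c → P? (tri (toℕ {3 ^ k} a) (toℕ b) (toℕ c))) → ∀ x → P (reduce k x)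
by-residues k {P} P? ok = every-residue k {P} (toWitness ok)

-- Truncations of R

truncate : R → ℕ → Tri
truncate x n = tri (seq (c0 x) n) (seq (c1 x) n) (seq (c2 x) n)

sumPowᵀ : ℕ → List Tri → Tri
sumPowᵀ k [] = 0ᵀ
sumPowᵀ k (t ∷ ts) = t ^ᵀ k +ᵀ sumPowᵀ k ts

truncate-^ : ∀ x k n → truncate (x ^R k) n ≡ truncate x n ^ᵀ k
truncate-^ x 0 n = refl
truncate-^ x 1 n = *ᵀ-identityʳ (truncate x n)
truncate-^ x (suc (suc k)) n =
  trans (cong (truncate x n *ᵀ_) (truncate-^ x (suc k) n)) (*ᵀ-comm (truncate x n) _)

truncate-sumPow : ∀ k ys n → truncate (sumPow k ys) n ≡ sumPowᵀ k (map (λ y → truncate y n) ys)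
truncate-sumPow k [] n = refl
truncate-sumPow k (y ∷ ys) n = cong₂ _+ᵀ_ (truncate-^ y k n) (truncate-sumPow k ys n)

≈⇒≋ : ∀ {x y} → x ≈ y → ∀ n → truncate x n ≋[ n ] truncate y n
≈⇒≋ (e₀ , e₁ , e₂) n = mk≋ (e₀ n) (e₁ n) (e₂ n)

≋⇒≈ : ∀ {x y} → (∀ n → truncate x n ≋[ n ] truncate y n) → x ≈ y
≋⇒≈ x≋y = (λ n → ≋₀ (x≋y n)) , (λ n → ≋₁ (x≋y n)) , (λ n → ≋₂ (x≋y n))

truncate-coherent : ∀ x {k m} → k ≤ m → truncate x m ≋[ k ] truncate x k
truncate-coherent x k≤m = go (≤⇒≤′ k≤m)
  where
  go : ∀ {k m} → k ≤′ m → truncate x m ≋[ k ] truncate x k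
  go ≤′-refl = ≋-refl
  go (≤′-step {m} k≤′m) =
    ≋-trans (≋-weaken (≤′⇒≤ k≤′m) (mk≋ (coh (c0 x) m) (coh (c1 x) m) (coh (c2 x) m))) (go k≤′m)

limit : (z : ℕ → Tri) → (∀ n → z (suc n) ≋[ n ] z n) → R
limit z coherent =
  ⟨ mkℤ₃ (t₀ ∘ z) (≋₀ ∘ coherent) , mkℤ₃ (t₁ ∘ z) (≋₁ ∘ coherent) , mkℤ₃ (t₂ ∘ z) (≋₂ ∘ coherent) ⟩

truncate-limit : ∀ z coherent n → truncate (limit z coherent) n ≡ z n
truncate-limit z coherent n with z n
... | tri _ _ _ = refl

-- Hensel lifting of z⁶ + s = x

-- Z ↦ Z + 3ʲ⁺¹·2Z·τ, where τ ≡ (X − Z⁶ − s)/3ʲ⁺² (mod 3) is written without subtraction;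
-- 2Z inverts 2Z⁵ modulo 3 as soon as Z⁶ ≡ 1.
hensel-step : ℕ → Tri → Tri → Tri → Tri
hensel-step j s X Z =
  Z +ᵀ ι (3 ^ suc j) *ᵀ (ι 2 *ᵀ Z *ᵀ (X div3^ᵀ (2 + j) +ᵀ ι 2 *ᵀ ((Z ^ᵀ 6 +ᵀ s) div3^ᵀ (2 + j))))

hensel-step-≋ : ∀ j s X Z → hensel-step j s X Z ≋[ suc j ] Z
hensel-step-≋ j s X Z = ≋-trans (≋-+ˡ Z (≋-vanish {suc j} {3 ^ suc j} _ ∣-refl)) (≡⇒≋ (+ᵀ-identityʳ Z))

hensel-correction : ∀ Z a b → Z ^ᵀ 6 ≋[ 1 ] 1ᵀ → ι 2 *ᵀ Z ^ᵀ 5 *ᵀ (ι 2 *ᵀ Z *ᵀ (b +ᵀ ι 2 *ᵀ a)) +ᵀ a ≋[ 1 ] b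
hensel-correction Z a b Z⁶≋1 = begin
  ι 2 *ᵀ Z ^ᵀ 5 *ᵀ (ι 2 *ᵀ Z *ᵀ (b +ᵀ ι 2 *ᵀ a)) +ᵀ a
    ≡⟨ expand Z a b ⟩
  ι 4 *ᵀ Z ^ᵀ 6 *ᵀ b +ᵀ (ι 8 *ᵀ Z ^ᵀ 6 +ᵀ 1ᵀ) *ᵀ a
    ≈⟨ ≋-+ (≋-*ʳ b (≋-*ˡ (ι 4) Z⁶≋1)) (≋-*ʳ a (≋-+ʳ 1ᵀ (≋-*ˡ (ι 8) Z⁶≋1))) ⟩
  ι 4 *ᵀ b +ᵀ ι 9 *ᵀ a
    ≈⟨ ≋-+ (≋-*ʳ b (mk≋ {ι 4} {1} {1ᵀ} refl refl refl)) (≋-*ʳ a (mk≋ {ι 9} {1} {0ᵀ} refl refl refl)) ⟩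
  1ᵀ *ᵀ b +ᵀ 0ᵀ *ᵀ a
    ≡⟨ cong₂ _+ᵀ_ (*ᵀ-identityˡ b) (*ᵀ-zeroˡ a) ⟩
  b +ᵀ 0ᵀ
    ≡⟨ +ᵀ-identityʳ b ⟩
  b ∎
  where
  open ≋-Reasoning 1
  expand : ∀ Z a b → ι 2 *ᵀ Z ^ᵀ 5 *ᵀ (ι 2 *ᵀ Z *ᵀ (b +ᵀ ι 2 *ᵀ a)) +ᵀ a ≡ ι 4 *ᵀ Z ^ᵀ 6 *ᵀ b +ᵀ (ι 8 *ᵀ Z ^ᵀ 6 +ᵀ 1ᵀ) *ᵀ a
  expand = solve-∀ Tri-ring

-- Because 3 ∣ 15, the quadratic term vanishes already for j = 0.
hensel-higher-terms-vanish : ∀ j y y′ → let C = ι (3 ^ suc j) in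
  ι 15 *ᵀ C *ᵀ C *ᵀ y +ᵀ C *ᵀ C *ᵀ C *ᵀ y′ ≋[ 3 + j ] 0ᵀ
hensel-higher-terms-vanish j y y′ = ≋-+
  (subst (_≋[ 3 + j ] 0ᵀ) (cong (_*ᵀ y) (sym (ι-ι-ι 15 c c))) (≋-vanish y (divides (5 * p) (15c² p))))
  (subst (_≋[ 3 + j ] 0ᵀ) (cong (_*ᵀ y′) (sym (ι-ι-ι c c c))) (≋-vanish y′ (divides (p * p) (c³ p))))
  where
  p c : ℕ
  p = 3 ^ j
  c = 3 ^ suc j
  ι-ι-ι : ∀ l m n → ι l *ᵀ ι m *ᵀ ι n ≡ ι (l * m * n)
  ι-ι-ι l m n = trans (cong (_*ᵀ ι n) (ι-*ᵀ-ι l m)) (ι-*ᵀ-ι (l * m) n)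
  15c² : ∀ p → 15 * (3 * p) * (3 * p) ≡ 5 * p * (3 * (3 * (3 * p)))
  15c² = ℕ-Solver.solve-∀
  c³ : ∀ p → 3 * p * (3 * p) * (3 * p) ≡ p * p * (3 * (3 * (3 * p)))
  c³ = ℕ-Solver.solve-∀

hensel-step-solves : ∀ j s X Z → Z ^ᵀ 6 ≋[ 1 ] 1ᵀ → Z ^ᵀ 6 +ᵀ s ≋[ 2 + j ] X →
                     hensel-step j s X Z ^ᵀ 6 +ᵀ s ≋[ 3 + j ] X
hensel-step-solves j s X Z Z⁶≋1 A≋X = begin
  (Z +ᵀ C *ᵀ d) ^ᵀ 6 +ᵀ s
    ≡⟨ cong (_+ᵀ s) (binomial-6 Z (C *ᵀ d)) ⟩
  Z ^ᵀ 6 +ᵀ ι 6 *ᵀ Z ^ᵀ 5 *ᵀ (C *ᵀ d) +ᵀ (C *ᵀ d) ^ᵀ 2 *ᵀ (ι 15 *ᵀ Z ^ᵀ 4 +ᵀ C *ᵀ d *ᵀ W) +ᵀ s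
    ≡⟨ regroup (Z ^ᵀ 6) (Z ^ᵀ 5) (Z ^ᵀ 4) W C d s ⟩
  A +ᵀ ι 3 *ᵀ C *ᵀ w +ᵀ (ι 15 *ᵀ C *ᵀ C *ᵀ (Z ^ᵀ 4 *ᵀ d ^ᵀ 2) +ᵀ C *ᵀ C *ᵀ C *ᵀ (d ^ᵀ 3 *ᵀ W))
    ≈⟨ ≋-+ˡ (A +ᵀ ι 3 *ᵀ C *ᵀ w) (hensel-higher-terms-vanish j (Z ^ᵀ 4 *ᵀ d ^ᵀ 2) (d ^ᵀ 3 *ᵀ W)) ⟩
  A +ᵀ ι 3 *ᵀ C *ᵀ w +ᵀ 0ᵀ
    ≡⟨ trans (+ᵀ-identityʳ (A +ᵀ ι 3 *ᵀ C *ᵀ w))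
             (cong (A +ᵀ_) (trans (cong (_*ᵀ w) (ι-*ᵀ-ι 3 (3 ^ suc j))) (ι-*ᵀ (3 ^ (2 + j)) w))) ⟩
  A +ᵀ 3 ^ (2 + j) ·ᵀ w
    ≈⟨ ≋-lift (2 + j) w A≋X (hensel-correction Z (A div3^ᵀ (2 + j)) (X div3^ᵀ (2 + j)) Z⁶≋1) ⟩
  X ∎
  where
  open ≋-Reasoning (3 + j)
  A C d w W : Tri
  A = Z ^ᵀ 6 +ᵀ s
  C = ι (3 ^ suc j)
  d = ι 2 *ᵀ Z *ᵀ (X div3^ᵀ (2 + j) +ᵀ ι 2 *ᵀ (A div3^ᵀ (2 + j)))
  w = ι 2 *ᵀ Z ^ᵀ 5 *ᵀ d
  W = ι 20 *ᵀ Z ^ᵀ 3 +ᵀ ι 15 *ᵀ Z ^ᵀ 2 *ᵀ (C *ᵀ d) +ᵀ ι 6 *ᵀ Z *ᵀ (C *ᵀ d) ^ᵀ 2 +ᵀ (C *ᵀ d) ^ᵀ 3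
  regroup : ∀ Z⁶ Z⁵ Z⁴ W C d s →
    Z⁶ +ᵀ ι 6 *ᵀ Z⁵ *ᵀ (C *ᵀ d) +ᵀ (C *ᵀ d) ^ᵀ 2 *ᵀ (ι 15 *ᵀ Z⁴ +ᵀ C *ᵀ d *ᵀ W) +ᵀ s ≡
    Z⁶ +ᵀ s +ᵀ ι 3 *ᵀ C *ᵀ (ι 2 *ᵀ Z⁵ *ᵀ d) +ᵀ (ι 15 *ᵀ C *ᵀ C *ᵀ (Z⁴ *ᵀ d ^ᵀ 2) +ᵀ C *ᵀ C *ᵀ C *ᵀ (d ^ᵀ 3 *ᵀ W))
  regroup = solve-∀ Tri-ring

hensel : ∀ x s u → u ^ᵀ 6 ≋[ 1 ] 1ᵀ → u ^ᵀ 6 +ᵀ s ≋[ 2 ] truncate x 2 →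
         Σ R λ z → ∀ n → truncate z n ^ᵀ 6 +ᵀ s ≋[ n ] truncate x n
hensel x s u u⁶≋1 u⁶+s≋x = limit approximation coherent , solves
  where
  approximation : ℕ → Tri
  approximation zero = u
  approximation (suc j) = hensel-step j s (truncate x (3 + j)) (approximation j)

  step-≋ : ∀ j → approximation (suc j) ≋[ suc j ] approximation j
  step-≋ j = hensel-step-≋ j s (truncate x (3 + j)) (approximation j)

  coherent : ∀ n → approximation (suc n) ≋[ n ] approximation n
  coherent n = ≋-weaken (n≤1+n n) (step-≋ n)

  approximation≋u : ∀ j → approximation j ≋[ 1 ] u
  approximation≋u zero = ≋-refl
  approximation≋u (suc j) = ≋-trans (≋-weaken (s≤s z≤n) (step-≋ j)) (approximation≋u j)

  approximation-solves : ∀ j → approximation j ^ᵀ 6 +ᵀ s ≋[ 2 + j ] truncate x (2 + j)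
  approximation-solves zero = u⁶+s≋x
  approximation-solves (suc j) = hensel-step-solves j s (truncate x (3 + j)) (approximation j)
    (≋-trans (≋-^ 6 (approximation≋u j)) u⁶≋1)
    (≋-trans (approximation-solves j) (≋-sym (truncate-coherent x (n≤1+n (2 + j)))))

  solves : ∀ n → truncate (limit approximation coherent) n ^ᵀ 6 +ᵀ s ≋[ n ] truncate x n
  solves n = subst (λ v → v ^ᵀ 6 +ᵀ s ≋[ n ] truncate x n) (sym (truncate-limit approximation coherent n))
    (≋-trans (≋-weaken (m≤n+m n 2) (approximation-solves n)) (truncate-coherent x (m≤n+m n 2)))

-- Sixth powers modulo 9

sixth-power-shift-by-3 : ∀ r w → (r +ᵀ ι 3 *ᵀ w) ^ᵀ 6 ≋[ 2 ] r ^ᵀ 6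
sixth-power-shift-by-3 r w = begin
  (r +ᵀ e) ^ᵀ 6                                             ≡⟨ binomial-6 r e ⟩
  r ^ᵀ 6 +ᵀ ι 6 *ᵀ r ^ᵀ 5 *ᵀ e +ᵀ e ^ᵀ 2 *ᵀ Q                ≡⟨ regroup (r ^ᵀ 6) (r ^ᵀ 5) Q w ⟩
  r ^ᵀ 6 +ᵀ ι 9 *ᵀ (ι 2 *ᵀ r ^ᵀ 5 *ᵀ w +ᵀ w ^ᵀ 2 *ᵀ Q)      ≈⟨ ≋-+ˡ (r ^ᵀ 6) (≋-vanish _ ∣-refl) ⟩
  r ^ᵀ 6 +ᵀ 0ᵀ                                              ≡⟨ +ᵀ-identityʳ (r ^ᵀ 6) ⟩
  r ^ᵀ 6                                                    ∎
  where
  open ≋-Reasoning 2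
  e Q : Tri
  e = ι 3 *ᵀ w
  Q = ι 15 *ᵀ r ^ᵀ 4 +ᵀ e *ᵀ (ι 20 *ᵀ r ^ᵀ 3 +ᵀ ι 15 *ᵀ r ^ᵀ 2 *ᵀ e +ᵀ ι 6 *ᵀ r *ᵀ e ^ᵀ 2 +ᵀ e ^ᵀ 3)
  regroup : ∀ R⁶ R⁵ Q w →
    R⁶ +ᵀ ι 6 *ᵀ R⁵ *ᵀ (ι 3 *ᵀ w) +ᵀ (ι 3 *ᵀ w) ^ᵀ 2 *ᵀ Q ≡ R⁶ +ᵀ ι 9 *ᵀ (ι 2 *ᵀ R⁵ *ᵀ w +ᵀ w ^ᵀ 2 *ᵀ Q)
  regroup = solve-∀ Tri-ring

≋-^6 : ∀ {x y} → x ≋[ 1 ] y → x ^ᵀ 6 ≋[ 2 ] y ^ᵀ 6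
≋-^6 {x} {y} x≋y = begin
  x ^ᵀ 6                                     ≡⟨ cong (_^ᵀ 6) (base-3-split x) ⟩
  (reduce 1 x +ᵀ ι 3 *ᵀ (x div3^ᵀ 1)) ^ᵀ 6   ≈⟨ sixth-power-shift-by-3 (reduce 1 x) (x div3^ᵀ 1) ⟩
  reduce 1 x ^ᵀ 6                            ≡⟨ cong (_^ᵀ 6) (≋⇒reduce-≡ x≋y) ⟩
  reduce 1 y ^ᵀ 6                            ≈⟨ sixth-power-shift-by-3 (reduce 1 y) (y div3^ᵀ 1) ⟨
  (reduce 1 y +ᵀ ι 3 *ᵀ (y div3^ᵀ 1)) ^ᵀ 6   ≡⟨ cong (_^ᵀ 6) (base-3-split y) ⟨
  y ^ᵀ 6                                     ∎
  where open ≋-Reasoning 2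

-- t₀ − t₁ modulo 9: it is 1 on sixth powers of units and 0 on the other sixth powers.
unitCount : Tri → ℕ
unitCount t = t₀ t + 8 * t₁ t

unitCount-+ : ∀ x y → unitCount (x +ᵀ y) ≡ unitCount x + unitCount y
unitCount-+ (tri a b _) (tri d e _) = regroup a b d e
  where
  regroup : ∀ a b d e → a + d + 8 * (b + e) ≡ a + 8 * b + (d + 8 * e)
  regroup = ℕ-Solver.solve-∀

unitCount-+-mod9 : ∀ x y a b → unitCount x ≡[mod3^ 2 ] a → unitCount y ≡[mod3^ 2 ] b →
                   unitCount (x +ᵀ y) ≡[mod3^ 2 ] (a + b)
unitCount-+-mod9 x y a b x≡a y≡b =
  trans (cong (_mod3^ 2) (unitCount-+ x y)) (mod3^-+ {2} {unitCount x} {a} {unitCount y} {b} x≡a y≡b)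

unitCount-≋ : ∀ {x y} → x ≋[ 2 ] y → unitCount x ≡[mod3^ 2 ] unitCount y
unitCount-≋ {tri a b _} {tri d e _} (mk≋ e₀ e₁ _) =
  mod3^-+ {2} {a} {d} {8 * b} {8 * e} e₀ (mod3^-* {2} {8} {8} {b} {e} refl e₁)

SixthPowerMod9 : Tri → Set
SixthPowerMod9 t = t ≋[ 2 ] 0ᵀ ⊎ (t ≋[ 1 ] 1ᵀ × unitCount t ≡[mod3^ 2 ] 1)

sixth-powers-of-residues : ∀ y → SixthPowerMod9 (reduce 1 y ^ᵀ 6)
sixth-powers-of-residues = by-residues 1
  (λ r → (r ^ᵀ 6 ≋?[ 2 ] 0ᵀ) ⊎-dec ((r ^ᵀ 6 ≋?[ 1 ] 1ᵀ) ×-dec (unitCount (r ^ᵀ 6) mod3^ 2 ≟ 1))) _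

sixth-powers-mod-9 : ∀ y → SixthPowerMod9 (y ^ᵀ 6)
sixth-powers-mod-9 y =
  Sum.map (≋-trans y⁶≋r⁶) (Product.map (≋-trans (≋-weaken (s≤s z≤n) y⁶≋r⁶)) (trans (unitCount-≋ y⁶≋r⁶)))
          (sixth-powers-of-residues y)
  where
  y⁶≋r⁶ : y ^ᵀ 6 ≋[ 2 ] reduce 1 y ^ᵀ 6
  y⁶≋r⁶ = ≋-^6 (≋-sym (≋-reduce 1 y))

UnitSummands : List Tri → Set
UnitSummands ts =
  Σ ℕ λ m → m ≤ length ts × unitCount (sumPowᵀ 6 ts) ≡[mod3^ 2 ] m × (m ≡ 0 → sumPowᵀ 6 ts ≋[ 2 ] 0ᵀ)

unit-summands : ∀ ts → UnitSummands ts
unit-summands [] = 0 , z≤n , refl , λ _ → ≋-refl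
unit-summands (t ∷ ts) = add (sixth-powers-mod-9 t) (unit-summands ts)
  where
  add : SixthPowerMod9 (t ^ᵀ 6) → UnitSummands ts → UnitSummands (t ∷ ts)
  add (inj₁ t⁶≋0) (m , m≤ , count , none) =
    m , m≤n⇒m≤1+n m≤ , unitCount-+-mod9 (t ^ᵀ 6) (sumPowᵀ 6 ts) 0 m (unitCount-≋ t⁶≋0) count ,
    λ m≡0 → ≋-+ t⁶≋0 (none m≡0)
  add (inj₂ (_ , count₁)) (m , m≤ , count , _) =
    suc m , s≤s m≤ , unitCount-+-mod9 (t ^ᵀ 6) (sumPowᵀ 6 ts) 1 m count₁ count , λ ()

3π²-not-sum-of-eight : ∀ ts → length ts ≤ 8 → ¬ (sumPowᵀ 6 ts ≋[ 2 ] tri 0 0 3)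
3π²-not-sum-of-eight ts len≤8 sum≋3π² with unit-summands ts
... | m , m≤len , count , none = 3≢0 (≋₂ (≋-trans (≋-sym sum≋3π²) (none m≡0)))
  where
  3≢0 : ¬ (3 ≡ 0)
  3≢0 ()
  m≡0 : m ≡ 0
  m≡0 = begin
    m                                  ≡⟨ m<n⇒m%n≡m (s≤s (≤-trans m≤len len≤8)) ⟨
    m mod3^ 2                          ≡⟨ count ⟨
    unitCount (sumPowᵀ 6 ts) mod3^ 2   ≡⟨ unitCount-≋ sum≋3π² ⟩
    0                                  ∎
    where open ≡-Reasoning

ConstantMod3 : Tri → Set
ConstantMod3 t = Σ ℕ λ a → t ≋[ 1 ] ι a

sumPow-constantMod3 : ∀ ts → ConstantMod3 (sumPowᵀ 6 ts)
sumPow-constantMod3 [] = 0 , ≋-refl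
sumPow-constantMod3 (t ∷ ts) = add (sixth-powers-mod-9 t) (sumPow-constantMod3 ts)
  where
  add : SixthPowerMod9 (t ^ᵀ 6) → ConstantMod3 (sumPowᵀ 6 ts) → ConstantMod3 (sumPowᵀ 6 (t ∷ ts))
  add (inj₁ t⁶≋0) (a , rest≋a) = a , ≋-+ (≋-weaken (s≤s z≤n) t⁶≋0) rest≋a
  add (inj₂ (t⁶≋1 , _)) (a , rest≋a) = suc a , ≋-+ t⁶≋1 rest≋a

-- (1 + βπ + γπ²)⁶ ≡ 1 + 6β + 6βπ + 6(β² + γ)π² (mod 9), which for β = 2b and γ = 2(c + b²)
-- is 1 + 3b + 3bπ + 3cπ².
sixthRoot : ℕ → ℕ → Tri
sixthRoot b c = tri 1 (2 * b) (2 * (c + b * b))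

sixthRoot-power : ∀ b c → let u = sixthRoot (b mod3^ 1) (c mod3^ 1) in
  u ^ᵀ 6 ≋[ 1 ] 1ᵀ × u ^ᵀ 6 ≋[ 2 ] tri (1 + 3 * (b mod3^ 1)) (3 * (b mod3^ 1)) (3 * (c mod3^ 1))
sixthRoot-power b c = by-residues 1
  (λ r → let u = sixthRoot (t₁ r) (t₂ r) in
         (u ^ᵀ 6 ≋?[ 1 ] 1ᵀ) ×-dec (u ^ᵀ 6 ≋?[ 2 ] tri (1 + 3 * t₁ r) (3 * t₁ r) (3 * t₂ r)))
  _ (tri 0 b c)

digit₁ : ℕ → ℕ
digit₁ a = (a / 3) mod3^ 1

-- m ≡ t₀ − 1 − t₁ (mod 9)
ones : Tri → ℕ
ones t = (t₀ t + 8 + 8 * t₁ t) mod3^ 2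

residue-decomposition : ∀ t → let r = reduce 2 t in r ≋[ 1 ] ι (t₀ r) →
  tri (1 + 3 * digit₁ (t₁ r)) (3 * digit₁ (t₁ r)) (3 * digit₁ (t₂ r)) +ᵀ ι (ones r) ≋[ 2 ] r
residue-decomposition = by-residues 2
  (λ r → (r ≋?[ 1 ] ι (t₀ r)) →-dec
         (tri (1 + 3 * digit₁ (t₁ r)) (3 * digit₁ (t₁ r)) (3 * digit₁ (t₂ r)) +ᵀ ι (ones r) ≋?[ 2 ] r))
  _

Decomposition : Tri → Set
Decomposition t = Σ Tri λ u → Σ ℕ λ m → m ≤ 8 × u ^ᵀ 6 ≋[ 1 ] 1ᵀ × u ^ᵀ 6 +ᵀ ι m ≋[ 2 ] t

decomposition : ∀ t → ConstantMod3 t → Decomposition t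
decomposition t (a , t≋a) =
  u , ones r , ≤-pred (m%n<n (t₀ r + 8 + 8 * t₁ r) 9) , proj₁ u⁶ ,
  ≋-trans (≋-+ʳ (ι (ones r)) (proj₂ u⁶)) (≋-trans (residue-decomposition t r-constant) (≋-reduce 2 t))
  where
  r u : Tri
  r = reduce 2 t
  u = sixthRoot (digit₁ (t₁ r)) (digit₁ (t₂ r))
  u⁶ : u ^ᵀ 6 ≋[ 1 ] 1ᵀ × u ^ᵀ 6 ≋[ 2 ] tri (1 + 3 * digit₁ (t₁ r)) (3 * digit₁ (t₁ r)) (3 * digit₁ (t₂ r))
  u⁶ = sixthRoot-power (t₁ r / 3) (t₂ r / 3)
  r≋a : r ≋[ 1 ] ι a
  r≋a = ≋-trans (≋-weaken (s≤s z≤n) (≋-reduce 2 t)) t≋a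
  r-constant : r ≋[ 1 ] ι (t₀ r)
  r-constant = mk≋ refl (≋₁ r≋a) (≋₂ r≋a)

truncate-ones : ∀ m n → truncate (sumPow 6 (replicate m 1R)) n ≡ ι m
truncate-ones zero n = refl
truncate-ones (suc m) n = cong (1ᵀ +ᵀ_) (truncate-ones m n)

nine-sixth-powers : ∀ x → Decomposition (truncate x 2) → Σ (List R) λ ys → length ys ≤ 9 × x ≈ sumPow 6 ys
nine-sixth-powers x (u , m , m≤8 , u⁶≋1 , u⁶+m≋x) =
  let z , z⁶+m≋x = hensel x (ι m) u u⁶≋1 u⁶+m≋x in
  z ∷ replicate m 1R ,
  s≤s (subst (_≤ 8) (sym (length-replicate m)) m≤8) ,
  ≋⇒≈ {x} {sumPow 6 (z ∷ replicate m 1R)} λ n →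
    ≋-sym (subst (_≋[ n ] truncate x n) (sym (cong₂ _+ᵀ_ (truncate-^ z 6 n) (truncate-ones m n))) (z⁶+m≋x n))

upper-bound : WaringBound 6 9
upper-bound x (ys , _ , x≈Σys) = nine-sixth-powers x (decomposition (truncate x 2) x-constantMod3)
  where
  ts : List Tri
  ts = map (λ y → truncate y 2) ys
  x≋Σ : truncate x 2 ≋[ 1 ] sumPowᵀ 6 ts
  x≋Σ = ≋-weaken (s≤s z≤n) (subst (truncate x 2 ≋[ 2 ]_) (truncate-sumPow 6 ys 2) (≈⇒≋ {x} {sumPow 6 ys} x≈Σys 2))
  x-constantMod3 : ConstantMod3 (truncate x 2)
  x-constantMod3 = let a , Σ≋a = sumPow-constantMod3 ts in a , ≋-trans x≋Σ Σ≋a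

x₀-summands : List R
x₀-summands = ⟨ const₃ 1 , const₃ 0 , const₃ 2 ⟩ ∷ replicate 8 1R

-- 8·1⁶ + (1 + 2π²)⁶ ≡ 3π² (mod 9)
x₀ : R
x₀ = sumPow 6 x₀-summands

x₀-needs-nine : ∀ ys → x₀ ≈ sumPow 6 ys → ¬ length ys ≤ 8
x₀-needs-nine ys x₀≈Σys len≤8 = 3π²-not-sum-of-eight ts (subst (_≤ 8) (sym (length-map _ ys)) len≤8) Σ≋3π²
  where
  ts : List Tri
  ts = map (λ y → truncate y 2) ys
  Σ≋3π² : sumPowᵀ 6 ts ≋[ 2 ] tri 0 0 3
  Σ≋3π² = ≋-trans (≋-sym (subst (truncate x₀ 2 ≋[ 2 ]_) (truncate-sumPow 6 ys 2) (≈⇒≋ {x₀} {sumPow 6 ys} x₀≈Σys 2)))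
                  (mk≋ {truncate x₀ 2} {2} {tri 0 0 3} refl refl refl)

lower-bound : ∀ h → 1 ≤ h → h < 9 → ¬ WaringBound 6 h
lower-bound h _ h<9 bound =
  let ys , len≤h , x₀≈Σys = bound x₀ (x₀-summands , s≤s z≤n , (λ _ → refl) , (λ _ → refl) , (λ _ → refl))
  in x₀-needs-nine ys x₀≈Σys (≤-trans len≤h (≤-pred h<9))

theorem4p2 : WaringNumber 6 9
theorem4p2 = s≤s z≤n , upper-bound , lower-bound
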